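{- Let $r,J,K$ be positive integers and let $c_{js},d_{ks}\in\mathbb{Z}_{\ge 0}$ for $1\le j\le J$, $1\le k\le K$, $1\le s\le r$. Put $C_j(p)=\sum_{s=1}^r c_{js}p_s$ and $D_k(p)=\sum_{s=1}^r d_{ks}p_s$. Assume: no $C_j$ and no $D_k$ is identically zero; $C_j\neq D_k$ for all $j,k$; for each $s$ some $c_{js}\neq 0$ or some $d_{ks}\neq 0$; and $\sum_{j=1}^J c_{js}=\sum_{k=1}^K d_{ks}$ for $s=1,\dots,r$. Let $n=r+J+K$, $N=n+r$, let $\mathbf{a}_1,\dots,\mathbf{a}_n$ be the standard unit basis vectors of $\mathbb{R}^n$, and for $s=1,\dots,r$ let $\mathbf{a}_{n+s}=(e_s,c_{1s},\dots,c_{Js},-d_{1s},\dots,-d_{Ks})$, where $e_s\in\mathbb{R}^r$ is the $s$-th standard unit vector; write $\mathbf{a}_j=(a_{1j},\dots,a_{nj})$. Let $L=\{l\in\mathbb{Z}^N:\sum_{i=1}^N l_i\mathbf{a}_i=\mathbf{0}\}$ and $\beta^{(0)}=(-1,\dots,-1,0,\dots,0)\in\mathbb{C}^n$ ($r+J$ entries $-1$, then $K$ zeros). Let $F(\lambda)$ be the series in variables $\lambda_1,\dots,\lambda_N$ $$F(\lambda)=(\lambda_1\cdots\lambda_{r+J})^{ -1}\sum_{p\in\mathbb{Z}_{\ge0}^r}(-1)^{\sum_{s}p_s+\sum_j C_j(p)}\frac{\prod_{j=1}^J C_j(p)!}{\prod_{k=1}^K D_k(p)!}\cdot\frac{\prod_{k=1}^K\lambda_{r+J+k}^{D_k(p)}\prod_{s=1}^r\lambda_{n+s}^{p_s}}{\prod_{s=1}^r\lambda_s^{p_s}\prod_{j=1}^J\lambda_{r+j}^{C_j(p)}}.$$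 Then $F(\lambda)$ satisfies the $A$-hypergeometric system with parameter $\beta^{(0)}$, i.e., it is annihilated by the box operators $$\Box_l=\prod_{l_i>0}\Big(\frac{\partial}{\partial\lambda_i}\Big)^{l_i}-\prod_{l_i<0}\Big(\frac{\partial}{\partial\lambda_i}\Big)^{ -l_i}\quad(l\in L)$$ and by the Euler operators $$Z_i=\sum_{j=1}^N a_{ij}\lambda_j\frac{\partial}{\partial\lambda_j}-\beta^{(0)}_i\quad(i=1,\dots,n).$$
   Context: The series $F(\lambda)$ is a formal series of Laurent monomials in $\lambda_1,\dots,\lambda_N$; the differential operators act termwise on monomials in the usual way. -}

module Defs where

open import Data.Nat as ℕ using (ℕ; zero; suc; _!)
open import Data.Nat.Properties using (_!≢0)
open import Data.Integer as ℤ using (ℤ; +_; -[1+_])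
import Data.Integer.Properties as ℤP
open import Data.Rational as ℚ using (ℚ; 0ℚ; 1ℚ)
open import Data.Fin using (Fin; zero; suc; splitAt; _↑ʳ_)
open import Data.Fin.Properties using (all?) renaming (_≟_ to _≟F_)
open import Data.Sum using (inj₁; inj₂)
open import Data.List using (foldr)
open import Data.List using () renaming (List to L)
open import Data.Bool using (if_then_else_)
open import Relation.Nullary using (yes; no; does)
open import Relation.Binary.PropositionalEquality using (_≡_)

sumℕ : ∀ {n} → (Fin n → ℕ) → ℕ
sumℕ {zero}  f = 0
sumℕ {suc n} f = f zero ℕ.+ sumℕ (λ i → f (suc i))

sumℤ : ∀ {n} → (Fin n → ℤ) → ℤ
sumℤ {zero}  f = + 0
sumℤ {suc n} f = f zero ℤ.+ sumℤ (λ i → f (suc i))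

sumℚ : ∀ {n} → (Fin n → ℚ) → ℚ
sumℚ {zero}  f = 0ℚ
sumℚ {suc n} f = f zero ℚ.+ sumℚ (λ i → f (suc i))

prodℚ : ∀ {n} → (Fin n → ℚ) → ℚ
prodℚ {zero}  f = 1ℚ
prodℚ {suc n} f = f zero ℚ.* prodℚ (λ i → f (suc i))

toℚ : ℤ → ℚ
toℚ z = z ℚ./ 1

sign : ℕ → ℚ
sign zero    = 1ℚ
sign (suc e) = ℚ.- sign e

pos : ℤ → ℕ
pos (+ n)    = n
pos -[1+ n ] = 0

neg : ℤ → ℕ
neg (+ n)    = 0
neg -[1+ n ] = suc n

-- Formal series of Laurent monomials in λ_1..λ_N with rational
-- coefficients: a series is its coefficient function on exponent vectors.

Series : ℕ → Set
Series N = (Fin N → ℤ) → ℚ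

shift : ∀ {N} → (Fin N → ℤ) → Fin N → ℤ → (Fin N → ℤ)
shift m i t j = if does (j ≟F i) then m j ℤ.+ t else m j

-- ∂/∂λ_i acting termwise:  ∂_i λ^m = m_i λ^(m - e_i), so the
-- coefficient of λ^m in ∂_i G is (m_i + 1) · [λ^(m+e_i)] G.
∂ : ∀ {N} → Fin N → Series N → Series N
∂ i G m = toℚ (m i ℤ.+ + 1) ℚ.* G (shift m i (+ 1))

mulλ : ∀ {N} → Fin N → Series N → Series N
mulλ i G m = G (shift m i (ℤ.- + 1))

∂^ : ∀ {N} → Fin N → ℕ → Series N → Series N
∂^ i zero    G = G
∂^ i (suc k) G = ∂ i (∂^ i k G)

∂mono : ∀ {N} → (Fin N → ℕ) → Series N → Series N
∂mono {N} k G = foldr (λ i H → ∂^ i (k i) H) G (Data.List.tabulate (λ i → i))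
  where import Data.List

_≐_ : ∀ {N} → Series N → Series N → Set
G ≐ H = ∀ m → G m ≡ H m

module Setup (r J K : ℕ) (c : Fin J → Fin r → ℕ) (d : Fin K → Fin r → ℕ) where

  n : ℕ
  n = r ℕ.+ J ℕ.+ K

  N : ℕ
  N = n ℕ.+ r

  C : Fin J → (Fin r → ℕ) → ℕ
  C j p = sumℕ (λ s → c j s ℕ.* p s)

  D : Fin K → (Fin r → ℕ) → ℕ
  D k p = sumℕ (λ s → d k s ℕ.* p s)

  δ : ∀ {m} → Fin m → Fin m → ℤ
  δ i j = if does (i ≟F j) then + 1 else + 0

  extra : Fin r → Fin n → ℤ
  extra s i with splitAt (r ℕ.+ J) i
  ... | inj₂ k = ℤ.- (+ d k s)
  ... | inj₁ i' with splitAt r i'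
  ...   | inj₁ s' = δ s' s
  ...   | inj₂ j  = + c j s

  col : Fin N → Fin n → ℤ
  col i with splitAt n i
  ... | inj₁ u = δ u
  ... | inj₂ s = extra s

  a : Fin n → Fin N → ℤ
  a i j = col j i

  inL : (Fin N → ℤ) → Set
  inL l = ∀ i → sumℤ (λ j → l j ℤ.* a i j) ≡ + 0

  β0 : Fin n → ℤ
  β0 i with splitAt (r ℕ.+ J) i
  ... | inj₁ _ = ℤ.- (+ 1)
  ... | inj₂ _ = + 0

  expo : (Fin r → ℕ) → Fin N → ℤ
  expo p i with splitAt n i
  ... | inj₂ s = + p s
  ... | inj₁ i' with splitAt (r ℕ.+ J) i'
  ...   | inj₂ k = + D k p
  ...   | inj₁ i'' with splitAt r i''
  ...     | inj₁ s = ℤ.- (+ p s) ℤ.- + 1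
  ...     | inj₂ j = ℤ.- (+ C j p) ℤ.- + 1

  coeff : (Fin r → ℕ) → ℚ
  coeff p = sign (sumℕ p ℕ.+ sumℕ (λ j → C j p))
            ℚ.* prodℚ (λ j → (+ (C j p !)) ℚ./ 1)
            ℚ.* prodℚ (λ k → ((+ 1) ℚ./ (D k p !)) {{D k p !≢0}})

  -- The map p ↦ expo p is
  -- injective (p is read off from the last r exponents), so the
  -- coefficient of λ^m is coeff p if m = expo p for the p given by the
  -- last r coordinates of m (all ≥ 0), and 0 otherwise.
  F : Series N
  F m with all? (λ s → + 0 ℤ.≤? m (n ↑ʳ s))
  ... | no _ = 0ℚ
  ... | yes _ = if does (all? (λ i → m i ℤP.≟ expo p i)) then coeff p else 0ℚ
    where
      p : Fin r → ℕ
      p s = ℤ.∣ m (n ↑ʳ s) ∣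

  box : (Fin N → ℤ) → Series N → Series N
  box l G m = ∂mono (λ i → pos (l i)) G m ℚ.- ∂mono (λ i → neg (l i)) G m

  euler : Fin n → Series N → Series N
  euler i G m = sumℚ (λ j → toℚ (a i j) ℚ.* mulλ j (∂ j G) m) ℚ.- toℚ (β0 i) ℚ.* G m

zeroS : ∀ {N} → Series N
zeroS _ = 0ℚ

{-# OPTIONS --safe #-}
-- The coefficient of λ^m in F is ∏ᵢ γ(mᵢ), with γ(x) = 1/x! for x ≥ 0 and
-- γ(−1−k) = (−1)^k k!, when m lies in the support S = {expo p}, and 0 otherwise;
-- S is exactly the set of integer solutions of A m = β⁽⁰⁾ whose last r
-- coordinates are nonnegative. Since y γ(y) = γ(y−1) for y ≠ 0, the coefficient
-- of λ^m in ∂^u F is ∏ᵢ γ(mᵢ) when m + u ∈ S and no coordinate passes from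
-- negative to nonnegative between m and m + u, and 0 when one does. For
-- l = u − v ∈ L, with u and v the positive and negative parts of l, both m + u
-- and m + v solve A x = β⁽⁰⁾, and comparing these cases shows that the two
-- sides of □_l agree. The Euler operator Z_i multiplies λ^m by (A m − β⁽⁰⁾)_i,
-- which vanishes on S.
module Submission where

open import Defs
open import Algebra.Definitions using (LeftZero; RightZero)
open import Algebra.Structures using (IsCommutativeMonoid)
open import Data.Bool using (if_then_else_)
open import Data.Empty using (⊥-elim)
open import Data.Fin using (Fin; zero; suc; splitAt; _↑ˡ_; _↑ʳ_)
import Data.Fin.Properties as FinP
open import Data.Fin.Properties using (all?; splitAt-↑ˡ; splitAt-↑ʳ; splitAt⁻¹-↑ˡ; splitAt⁻¹-↑ʳ) renaming (_≟_ to _≟F_)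
open import Data.Integer as ℤ using (ℤ; +_; -[1+_]; -1ℤ; +≤+; -<+)
import Data.Integer.Properties as ℤP
open import Algebra.Properties.AbelianGroup ℤP.+-0-abelianGroup using (x∙y⁻¹≈ε⇒x≈y)
open import Data.Integer.Solver renaming (module +-*-Solver to ℤ-Solver)
open import Data.List using (foldr; tabulate)
open import Data.Nat as ℕ using (ℕ; zero; suc; _<_; _!; z≤n)
import Data.Nat.Properties as ℕP
open import Data.Nat.Properties using (_!≢0)
open import Data.Product using (Σ; _×_; _,_)
open import Data.Rational as ℚ using (ℚ; 0ℚ; 1ℚ)
import Data.Rational.Properties as ℚP
open import Data.Rational.Solver renaming (module +-*-Solver to ℚ-Solver)
open import Data.Rational.Unnormalised as ℚᵘ using (mkℚᵘ; *≡*)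
import Data.Rational.Unnormalised.Properties as ℚᵘP
open import Data.Sum using (_⊎_; inj₁; inj₂; swap)
open import Function using (_∘_; id)
open import Function.Definitions using (Injective)
open import Relation.Nullary using (¬_; Dec; yes; no; does)
open import Relation.Nullary.Decidable using (dec-true; dec-false)
open import Relation.Binary.PropositionalEquality

-- ⨁ is a field rather than a fold defined here, so that sumℕ, sumℤ, sumℚ and
-- prodℚ from Defs are instances whose recursion equations hold by refl.
record BigOperator (A : Set) : Set where
  infixl 7 _∙_
  field
    _∙_ : A → A → A
    ε : A
    isCommutativeMonoid : IsCommutativeMonoid _≡_ _∙_ ε
    ⨁ : ∀ {n} → (Fin n → A) → A
    ⨁-zero : (f : Fin 0 → A) → ⨁ f ≡ ε
    ⨁-suc : ∀ {n} (f : Fin (suc n) → A) → ⨁ f ≡ f zero ∙ ⨁ (f ∘ suc)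

  open IsCommutativeMonoid isCommutativeMonoid
    using (assoc; comm; identityˡ; identityʳ)

  ⨁-cong : ∀ {n} {f g : Fin n → A} → (∀ i → f i ≡ g i) → ⨁ f ≡ ⨁ g
  ⨁-cong {zero} {f} {g} f≗g = trans (⨁-zero f) (sym (⨁-zero g))
  ⨁-cong {suc n} {f} {g} f≗g = begin
    ⨁ f                   ≡⟨ ⨁-suc f ⟩
    f zero ∙ ⨁ (f ∘ suc)  ≡⟨ cong₂ _∙_ (f≗g zero) (⨁-cong (f≗g ∘ suc)) ⟩
    g zero ∙ ⨁ (g ∘ suc)  ≡⟨ sym (⨁-suc g) ⟩
    ⨁ g                   ∎
    where open ≡-Reasoning

  ⨁-ε : ∀ {n} {f : Fin n → A} → (∀ i → f i ≡ ε) → ⨁ f ≡ ε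
  ⨁-ε {zero} {f} _ = ⨁-zero f
  ⨁-ε {suc n} {f} f≗ε = begin
    ⨁ f                   ≡⟨ ⨁-suc f ⟩
    f zero ∙ ⨁ (f ∘ suc)  ≡⟨ cong₂ _∙_ (f≗ε zero) (⨁-ε (f≗ε ∘ suc)) ⟩
    ε ∙ ε                 ≡⟨ identityˡ ε ⟩
    ε                     ∎
    where open ≡-Reasoning

  ⨁-∙ : ∀ {n} (f g : Fin n → A) → ⨁ (λ i → f i ∙ g i) ≡ ⨁ f ∙ ⨁ g
  ⨁-∙ {zero} f g = trans (⨁-zero _) (sym (trans (cong₂ _∙_ (⨁-zero f) (⨁-zero g)) (identityˡ ε)))
  ⨁-∙ {suc n} f g = begin
    ⨁ (λ i → f i ∙ g i)                          ≡⟨ ⨁-suc _ ⟩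
    (f zero ∙ g zero) ∙ ⨁ (λ i → f (suc i) ∙ g (suc i))
      ≡⟨ cong ((f zero ∙ g zero) ∙_) (⨁-∙ (f ∘ suc) (g ∘ suc)) ⟩
    (f zero ∙ g zero) ∙ (⨁ (f ∘ suc) ∙ ⨁ (g ∘ suc)) ≡⟨ interchange _ _ _ _ ⟩
    (f zero ∙ ⨁ (f ∘ suc)) ∙ (g zero ∙ ⨁ (g ∘ suc)) ≡⟨ sym (cong₂ _∙_ (⨁-suc f) (⨁-suc g)) ⟩
    ⨁ f ∙ ⨁ g                                    ∎
    where
    open ≡-Reasoning
    interchange : ∀ a b c d → (a ∙ b) ∙ (c ∙ d) ≡ (a ∙ c) ∙ (b ∙ d)
    interchange a b c d = begin
      (a ∙ b) ∙ (c ∙ d) ≡⟨ assoc a b (c ∙ d) ⟩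
      a ∙ (b ∙ (c ∙ d)) ≡⟨ cong (a ∙_) (sym (assoc b c d)) ⟩
      a ∙ ((b ∙ c) ∙ d) ≡⟨ cong (λ x → a ∙ (x ∙ d)) (comm b c) ⟩
      a ∙ ((c ∙ b) ∙ d) ≡⟨ cong (a ∙_) (assoc c b d) ⟩
      a ∙ (c ∙ (b ∙ d)) ≡⟨ sym (assoc a c (b ∙ d)) ⟩
      (a ∙ c) ∙ (b ∙ d) ∎

  ⨁-↑ : ∀ m {k} (f : Fin (m ℕ.+ k) → A) → ⨁ f ≡ ⨁ (f ∘ (_↑ˡ k)) ∙ ⨁ (f ∘ (m ↑ʳ_))
  ⨁-↑ zero f = sym (trans (cong (_∙ ⨁ f) (⨁-zero _)) (identityˡ (⨁ f)))
  ⨁-↑ (suc m) {k} f = begin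
    ⨁ f                                                   ≡⟨ ⨁-suc f ⟩
    f zero ∙ ⨁ (f ∘ suc)                                  ≡⟨ cong (f zero ∙_) (⨁-↑ m (f ∘ suc)) ⟩
    f zero ∙ (⨁ (f ∘ suc ∘ (_↑ˡ k)) ∙ ⨁ (f ∘ suc ∘ (m ↑ʳ_))) ≡⟨ sym (assoc _ _ _) ⟩
    (f zero ∙ ⨁ (f ∘ suc ∘ (_↑ˡ k))) ∙ ⨁ (f ∘ suc ∘ (m ↑ʳ_))
      ≡⟨ cong (_∙ ⨁ (f ∘ (suc m ↑ʳ_))) (sym (⨁-suc _)) ⟩
    ⨁ (f ∘ (_↑ˡ k)) ∙ ⨁ (f ∘ (suc m ↑ʳ_))                 ∎
    where open ≡-Reasoning

  ⨁-single : ∀ {n} (f : Fin n → A) i → (∀ j → j ≢ i → f j ≡ ε) → ⨁ f ≡ f i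
  ⨁-single {suc n} f zero others = begin
    ⨁ f                   ≡⟨ ⨁-suc f ⟩
    f zero ∙ ⨁ (f ∘ suc)  ≡⟨ cong (f zero ∙_) (⨁-ε (λ j → others (suc j) λ ())) ⟩
    f zero ∙ ε            ≡⟨ identityʳ (f zero) ⟩
    f zero                ∎
    where open ≡-Reasoning
  ⨁-single {suc n} f (suc i) others = begin
    ⨁ f                   ≡⟨ ⨁-suc f ⟩
    f zero ∙ ⨁ (f ∘ suc)  ≡⟨ cong₂ _∙_ (others zero λ ())
                                      (⨁-single (f ∘ suc) i λ j j≢i → others (suc j) (j≢i ∘ FinP.suc-injective)) ⟩
    ε ∙ f (suc i)         ≡⟨ identityˡ (f (suc i)) ⟩
    f (suc i)             ∎
    where open ≡-Reasoning

  ⨁-zeroFactor : ∀ {z} → LeftZero _≡_ z _∙_ → RightZero _≡_ z _∙_ →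
                 ∀ {n} (f : Fin n → A) i → f i ≡ z → ⨁ f ≡ z
  ⨁-zeroFactor zeroˡ zeroʳ f zero fi≡z = trans (⨁-suc f) (trans (cong (_∙ ⨁ (f ∘ suc)) fi≡z) (zeroˡ _))
  ⨁-zeroFactor zeroˡ zeroʳ f (suc i) fi≡z =
    trans (⨁-suc f) (trans (cong (f zero ∙_) (⨁-zeroFactor zeroˡ zeroʳ (f ∘ suc) i fi≡z)) (zeroʳ _))

⨁-homo : ∀ {A B} (𝔸 : BigOperator A) (𝔹 : BigOperator B) (h : A → B) →
         h (BigOperator.ε 𝔸) ≡ BigOperator.ε 𝔹 →
         (∀ x y → h (BigOperator._∙_ 𝔸 x y) ≡ BigOperator._∙_ 𝔹 (h x) (h y)) →
         ∀ {n} (f : Fin n → A) → h (BigOperator.⨁ 𝔸 f) ≡ BigOperator.⨁ 𝔹 (h ∘ f)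
⨁-homo 𝔸 𝔹 h h-ε h-∙ {zero} f = begin
  h (A.⨁ f)    ≡⟨ cong h (A.⨁-zero f) ⟩
  h A.ε        ≡⟨ h-ε ⟩
  B.ε          ≡⟨ sym (B.⨁-zero (h ∘ f)) ⟩
  B.⨁ (h ∘ f)  ∎
  where
  module A = BigOperator 𝔸
  module B = BigOperator 𝔹
  open ≡-Reasoning
⨁-homo 𝔸 𝔹 h h-ε h-∙ {suc n} f = begin
  h (A.⨁ f)                         ≡⟨ cong h (A.⨁-suc f) ⟩
  h (f zero A.∙ A.⨁ (f ∘ suc))      ≡⟨ h-∙ _ _ ⟩
  h (f zero) B.∙ h (A.⨁ (f ∘ suc))  ≡⟨ cong (h (f zero) B.∙_) (⨁-homo 𝔸 𝔹 h h-ε h-∙ (f ∘ suc)) ⟩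
  h (f zero) B.∙ B.⨁ (h ∘ f ∘ suc)  ≡⟨ sym (B.⨁-suc (h ∘ f)) ⟩
  B.⨁ (h ∘ f)                       ∎
  where
  module A = BigOperator 𝔸
  module B = BigOperator 𝔹
  open ≡-Reasoning

Σℕ : BigOperator ℕ
Σℕ = record { isCommutativeMonoid = ℕP.+-0-isCommutativeMonoid ; ⨁ = sumℕ ; ⨁-zero = λ _ → refl ; ⨁-suc = λ _ → refl }

Σℤ : BigOperator ℤ
Σℤ = record { isCommutativeMonoid = ℤP.+-0-isCommutativeMonoid ; ⨁ = sumℤ ; ⨁-zero = λ _ → refl ; ⨁-suc = λ _ → refl }

Σℚ : BigOperator ℚ
Σℚ = record { isCommutativeMonoid = ℚP.+-0-isCommutativeMonoid ; ⨁ = sumℚ ; ⨁-zero = λ _ → refl ; ⨁-suc = λ _ → refl }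

Πℚ : BigOperator ℚ
Πℚ = record { isCommutativeMonoid = ℚP.*-1-isCommutativeMonoid ; ⨁ = prodℚ ; ⨁-zero = λ _ → refl ; ⨁-suc = λ _ → refl }

module Σℤ = BigOperator Σℤ
module Σℚ = BigOperator Σℚ
module Πℚ = BigOperator Πℚ

/-cross : ∀ a b c d .{{_ : ℕ.NonZero c}} .{{_ : ℕ.NonZero d}} →
          a ℤ.* + d ≡ b ℤ.* + c → a ℚ./ c ≡ b ℚ./ d
/-cross a b (suc c) (suc d) eq = ℚP.fromℚᵘ-cong {mkℚᵘ a c} {mkℚᵘ b d} (*≡* eq)

/-*-/ : ∀ a b c d .{{_ : ℕ.NonZero c}} .{{_ : ℕ.NonZero d}} →
        (a ℚ./ c) ℚ.* (b ℚ./ d) ≡ ((a ℤ.* b) ℚ./ (c ℕ.* d)) {{ℕP.m*n≢0 c d}}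
/-*-/ a b (suc c) (suc d) = ℚP.toℚᵘ-injective (begin
  ℚ.toℚᵘ ((a ℚ./ suc c) ℚ.* (b ℚ./ suc d))
    ≈⟨ ℚP.toℚᵘ-homo-* (a ℚ./ suc c) (b ℚ./ suc d) ⟩
  ℚ.toℚᵘ (a ℚ./ suc c) ℚᵘ.* ℚ.toℚᵘ (b ℚ./ suc d)
    ≈⟨ ℚᵘP.*-cong (ℚP.toℚᵘ-fromℚᵘ (mkℚᵘ a c)) (ℚP.toℚᵘ-fromℚᵘ (mkℚᵘ b d)) ⟩
  mkℚᵘ (a ℤ.* b) (d ℕ.+ c ℕ.* suc d)
    ≈⟨ ℚᵘP.≃-sym (ℚP.toℚᵘ-fromℚᵘ (mkℚᵘ (a ℤ.* b) (d ℕ.+ c ℕ.* suc d))) ⟩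
  ℚ.toℚᵘ ((a ℤ.* b) ℚ./ (suc c ℕ.* suc d)) ∎)
  where open ℚᵘP.≃-Reasoning

toℚ-* : ∀ a b → toℚ (a ℤ.* b) ≡ toℚ a ℚ.* toℚ b
toℚ-* a b = sym (/-*-/ a b 1 1)

toℚ-+ : ∀ a b → toℚ (a ℤ.+ b) ≡ toℚ a ℚ.+ toℚ b
toℚ-+ a b = ℚP.toℚᵘ-injective (begin
  ℚ.toℚᵘ (toℚ (a ℤ.+ b))             ≈⟨ ℚP.toℚᵘ-fromℚᵘ (mkℚᵘ (a ℤ.+ b) 0) ⟩
  mkℚᵘ (a ℤ.+ b) 0
    ≈⟨ *≡* (cong (ℤ._* + 1) (sym (cong₂ ℤ._+_ (ℤP.*-identityʳ a) (ℤP.*-identityʳ b)))) ⟩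
  mkℚᵘ a 0 ℚᵘ.+ mkℚᵘ b 0
    ≈⟨ ℚᵘP.≃-sym (ℚᵘP.+-cong (ℚP.toℚᵘ-fromℚᵘ (mkℚᵘ a 0)) (ℚP.toℚᵘ-fromℚᵘ (mkℚᵘ b 0))) ⟩
  ℚ.toℚᵘ (toℚ a) ℚᵘ.+ ℚ.toℚᵘ (toℚ b) ≈⟨ ℚᵘP.≃-sym (ℚP.toℚᵘ-homo-+ (toℚ a) (toℚ b)) ⟩
  ℚ.toℚᵘ (toℚ a ℚ.+ toℚ b)           ∎)
  where open ℚᵘP.≃-Reasoning

sign-+ : ∀ a b → sign (a ℕ.+ b) ≡ sign a ℚ.* sign b
sign-+ zero b = sym (ℚP.*-identityˡ _)
sign-+ (suc a) b = trans (cong ℚ.-_ (sign-+ a b)) (ℚP.neg-distribˡ-* (sign a) (sign b))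

sum-δ : ∀ {M} (f : Fin M → ℤ) {i} (δᵢ : Fin M → ℤ) → δᵢ i ≡ + 1 → (∀ {u} → u ≢ i → δᵢ u ≡ + 0) →
        sumℤ (λ u → f u ℤ.* δᵢ u) ≡ f i
sum-δ f {i} δᵢ δᵢ-≡ δᵢ-≢ = begin
  sumℤ (λ u → f u ℤ.* δᵢ u) ≡⟨ Σℤ.⨁-single (λ u → f u ℤ.* δᵢ u) i
                                 (λ u u≢i → trans (cong (f u ℤ.*_) (δᵢ-≢ u≢i)) (ℤP.*-zeroʳ (f u))) ⟩
  f i ℤ.* δᵢ i              ≡⟨ trans (cong (f i ℤ.*_) δᵢ-≡) (ℤP.*-identityʳ (f i)) ⟩
  f i                       ∎
  where open ≡-Reasoning

Σℤ-neg : ∀ {M} (f : Fin M → ℤ) → sumℤ (λ t → ℤ.- f t) ≡ ℤ.- sumℤ f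
Σℤ-neg f = sym (⨁-homo Σℤ Σℤ ℤ.-_ refl ℤP.neg-distrib-+ f)

weighted-sum : ∀ {M} (e p : Fin M → ℕ) → + sumℕ (λ s → e s ℕ.* p s) ≡ sumℤ (λ t → + p t ℤ.* + e t)
weighted-sum e p = trans (⨁-homo Σℕ Σℤ +_ refl ℤP.pos-+ (λ s → e s ℕ.* p s))
  (Σℤ.⨁-cong λ t → trans (ℤP.pos-* (e t) (p t)) (ℤP.*-comm (+ e t) (+ p t)))

-x-1+x≡-1 : ∀ x → (ℤ.- x ℤ.- + 1) ℤ.+ x ≡ -[1+ 0 ]
-x-1+x≡-1 = solve 1 (λ x → (:- x :- con (+ 1)) :+ x := :- con (+ 1)) refl
  where open ℤ-Solver

x+y≡b⇒x≡-y+b : ∀ x y b → x ℤ.+ y ≡ b → x ≡ ℤ.- y ℤ.+ b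
x+y≡b⇒x≡-y+b x y b eq = trans (solve 2 (λ x y → x := :- y :+ (x :+ y)) refl x y) (cong (ℤ._+_ (ℤ.- y)) eq)
  where open ℤ-Solver

-+a-1≡-[1+a] : ∀ a → ℤ.- (+ a) ℤ.- + 1 ≡ -[1+ a ]
-+a-1≡-[1+a] zero = refl
-+a-1≡-[1+a] (suc a) = cong (λ z → -[1+ suc z ]) (ℕP.+-identityʳ a)

Πℚ-sign : ∀ {M} (e : Fin M → ℕ) → prodℚ (λ i → sign (e i)) ≡ sign (sumℕ e)
Πℚ-sign e = sym (⨁-homo Σℕ Πℚ sign refl sign-+ e)

pos-neg-disjoint : ∀ z → pos z ≡ 0 ⊎ neg z ≡ 0
pos-neg-disjoint (+ _) = inj₂ refl
pos-neg-disjoint -[1+ _ ] = inj₁ refl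

pos-neg-split : ∀ z → + pos z ≡ + neg z ℤ.+ z
pos-neg-split (+ k) = sym (ℤP.+-identityˡ (+ k))
pos-neg-split -[1+ k ] = sym (ℤP.+-inverseʳ (+ suc k))

γ : ℤ → ℚ
γ (+ n) = ((+ 1) ℚ./ (n !)) {{n !≢0}}
γ -[1+ k ] = sign k ℚ.* toℚ (+ (k !))

rising : ℤ → ℕ → ℚ
rising x zero = 1ℚ
rising x (suc k) = toℚ (x ℤ.+ + 1) ℚ.* rising (x ℤ.+ + 1) k

γ-recurrence : ∀ x → x ≢ -[1+ 0 ] → toℚ (x ℤ.+ + 1) ℚ.* γ (x ℤ.+ + 1) ≡ γ x
γ-recurrence (+ a) _ rewrite ℕP.+-comm a 1 =
  trans (/-*-/ (+ suc a) (+ 1) 1 (suc a !) {{_}} {{suc a !≢0}})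
        (/-cross (+ suc a ℤ.* + 1) (+ 1) (1 ℕ.* (suc a !)) (a !) {{ℕP.m*n≢0 1 (suc a !) {{_}} {{suc a !≢0}}}} {{a !≢0}} (begin
          (+ suc a ℤ.* + 1) ℤ.* + (a !)  ≡⟨ cong (ℤ._* + (a !)) (ℤP.*-identityʳ (+ suc a)) ⟩
          + suc a ℤ.* + (a !)            ≡⟨ sym (ℤP.pos-* (suc a) (a !)) ⟩
          + (suc a !)                    ≡⟨ cong +_ (sym (ℕP.*-identityˡ (suc a !))) ⟩
          + (1 ℕ.* suc a !)              ≡⟨ sym (ℤP.*-identityˡ _) ⟩
          + 1 ℤ.* + (1 ℕ.* suc a !)      ∎))
  where open ≡-Reasoning
γ-recurrence -[1+ zero ] -1≢-1 = ⊥-elim (-1≢-1 refl)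
γ-recurrence -[1+ suc b ] _ = begin
  toℚ -[1+ b ] ℚ.* (sign b ℚ.* toℚ (+ (b !)))
    ≡⟨ solve 3 (λ x s f → (:- x) :* (s :* f) := :- (s :* (x :* f))) refl (toℚ (+ suc b)) (sign b) (toℚ (+ (b !))) ⟩
  ℚ.- (sign b ℚ.* (toℚ (+ suc b) ℚ.* toℚ (+ (b !))))
    ≡⟨ cong (λ y → ℚ.- (sign b ℚ.* y)) (sym (toℚ-* (+ suc b) (+ (b !)))) ⟩
  ℚ.- (sign b ℚ.* toℚ (+ suc b ℤ.* + (b !)))
    ≡⟨ cong (λ y → ℚ.- (sign b ℚ.* toℚ y)) (sym (ℤP.pos-* (suc b) (b !))) ⟩
  ℚ.- (sign b ℚ.* toℚ (+ (suc b !)))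
    ≡⟨ ℚP.neg-distribˡ-* (sign b) _ ⟩
  sign (suc b) ℚ.* toℚ (+ (suc b !)) ∎
  where
  open ≡-Reasoning
  open ℚ-Solver

γ-reflection : ∀ k → γ -[1+ k ] ℚ.* γ (+ k) ≡ sign k
γ-reflection k = begin
  (sign k ℚ.* toℚ (+ (k !))) ℚ.* γ (+ k)  ≡⟨ ℚP.*-assoc (sign k) (toℚ (+ (k !))) (γ (+ k)) ⟩
  sign k ℚ.* (toℚ (+ (k !)) ℚ.* γ (+ k))  ≡⟨ cong (sign k ℚ.*_) factorial-cancel ⟩
  sign k ℚ.* 1ℚ                           ≡⟨ ℚP.*-identityʳ (sign k) ⟩
  sign k                                  ∎
  where
  open ≡-Reasoning
  factorial-cancel : toℚ (+ (k !)) ℚ.* γ (+ k) ≡ 1ℚ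
  factorial-cancel =
    trans (/-*-/ (+ (k !)) (+ 1) 1 (k !) {{_}} {{k !≢0}})
          (/-cross (+ (k !) ℤ.* + 1) (+ 1) (1 ℕ.* (k !)) 1 {{ℕP.m*n≢0 1 (k !) {{_}} {{k !≢0}}}} {{_}} (begin
            (+ (k !) ℤ.* + 1) ℤ.* + 1  ≡⟨ ℤP.*-identityʳ _ ⟩
            + (k !) ℤ.* + 1            ≡⟨ ℤP.*-identityʳ _ ⟩
            + (k !)                    ≡⟨ cong +_ (sym (ℕP.*-identityˡ (k !))) ⟩
            + (1 ℕ.* k !)              ≡⟨ sym (ℤP.*-identityˡ _) ⟩
            + 1 ℤ.* + (1 ℕ.* k !)      ∎))

rising-γ : ∀ k x → ¬ (x ℤ.< + 0 × + 0 ℤ.≤ x ℤ.+ + k) → rising x k ℚ.* γ (x ℤ.+ + k) ≡ γ x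
rising-γ zero x _ = trans (ℚP.*-identityˡ _) (cong γ (ℤP.+-identityʳ x))
rising-γ (suc k) x no-crossing = begin
  (toℚ (x ℤ.+ + 1) ℚ.* rising (x ℤ.+ + 1) k) ℚ.* γ (x ℤ.+ + suc k)
    ≡⟨ cong (λ y → (toℚ (x ℤ.+ + 1) ℚ.* rising (x ℤ.+ + 1) k) ℚ.* γ y) (sym (ℤP.+-assoc x (+ 1) (+ k))) ⟩
  (toℚ (x ℤ.+ + 1) ℚ.* rising (x ℤ.+ + 1) k) ℚ.* γ ((x ℤ.+ + 1) ℤ.+ + k)
    ≡⟨ ℚP.*-assoc (toℚ (x ℤ.+ + 1)) _ _ ⟩
  toℚ (x ℤ.+ + 1) ℚ.* (rising (x ℤ.+ + 1) k ℚ.* γ ((x ℤ.+ + 1) ℤ.+ + k))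
    ≡⟨ cong (toℚ (x ℤ.+ + 1) ℚ.*_) (rising-γ k (x ℤ.+ + 1) no-crossing′) ⟩
  toℚ (x ℤ.+ + 1) ℚ.* γ (x ℤ.+ + 1)
    ≡⟨ γ-recurrence x x≢-1 ⟩
  γ x ∎
  where
  open ≡-Reasoning
  x≢-1 : x ≢ -[1+ 0 ]
  x≢-1 refl = no-crossing (-<+ , +≤+ z≤n)
  no-crossing′ : ¬ (x ℤ.+ + 1 ℤ.< + 0 × + 0 ℤ.≤ (x ℤ.+ + 1) ℤ.+ + k)
  no-crossing′ (x+1<0 , 0≤x+1+k) = no-crossing
    (ℤP.≤-<-trans (ℤP.i≤i+j x (+ 1)) x+1<0 , subst (+ 0 ℤ.≤_) (ℤP.+-assoc x (+ 1) (+ k)) 0≤x+1+k)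

rising-crossing : ∀ k x → x ℤ.< + 0 → + 0 ℤ.≤ x ℤ.+ + k → rising x k ≡ 0ℚ
rising-crossing zero x x<0 0≤x = ⊥-elim (ℤP.<⇒≱ x<0 (subst (+ 0 ℤ.≤_) (ℤP.+-identityʳ x) 0≤x))
rising-crossing (suc k) (+ a) (ℤ.+<+ ()) _
rising-crossing (suc k) -[1+ zero ] _ _ = ℚP.*-zeroˡ (rising (+ 0) k)
rising-crossing (suc k) -[1+ suc b ] _ 0≤x+k =
  trans (cong (toℚ -[1+ b ] ℚ.*_)
          (rising-crossing k -[1+ b ] -<+ (subst (+ 0 ℤ.≤_) (sym (ℤP.+-assoc -[1+ suc b ] (+ 1) (+ k))) 0≤x+k)))
        (ℚP.*-zeroʳ (toℚ -[1+ b ]))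

module _ {N : ℕ} where

  Extensional : Series N → Set
  Extensional G = ∀ {x y} → (∀ i → x i ≡ y i) → G x ≡ G y

  _⊕_ : (Fin N → ℤ) → (Fin N → ℕ) → (Fin N → ℤ)
  (m ⊕ k) i = m i ℤ.+ + k i

  shift-≡ : ∀ (m : Fin N → ℤ) i t → shift m i t i ≡ m i ℤ.+ t
  shift-≡ m i t with i ≟F i
  ... | yes _ = refl
  ... | no i≢i = ⊥-elim (i≢i refl)

  shift-≢ : ∀ (m : Fin N → ℤ) i t j → j ≢ i → shift m i t j ≡ m j
  shift-≢ m i t j j≢i with j ≟F i
  ... | yes j≡i = ⊥-elim (j≢i j≡i)
  ... | no _ = refl

  shift-shift : ∀ (m : Fin N → ℤ) i s t j → shift (shift m i s) i t j ≡ shift m i (s ℤ.+ t) j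
  shift-shift m i s t j with j ≟F i
  ... | yes _ = ℤP.+-assoc (m j) s t
  ... | no _ = refl

  shift-+0 : ∀ (m : Fin N → ℤ) i j → shift m i (+ 0) j ≡ m j
  shift-+0 m i j with j ≟F i
  ... | yes _ = ℤP.+-identityʳ (m j)
  ... | no _ = refl

  ∂^-coeff : ∀ i k {G} → Extensional G → ∀ m →
             ∂^ i k G m ≡ rising (m i) k ℚ.* G (shift m i (+ k))
  ∂^-coeff i zero {G} G-ext m = trans (G-ext λ j → sym (shift-+0 m i j)) (sym (ℚP.*-identityˡ _))
  ∂^-coeff i (suc k) {G} G-ext m = begin
    toℚ (m i ℤ.+ + 1) ℚ.* ∂^ i k G m₁
      ≡⟨ cong (toℚ (m i ℤ.+ + 1) ℚ.*_) (∂^-coeff i k G-ext m₁) ⟩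
    toℚ (m i ℤ.+ + 1) ℚ.* (rising (m₁ i) k ℚ.* G (shift m₁ i (+ k)))
      ≡⟨ cong₂ (λ x y → toℚ (m i ℤ.+ + 1) ℚ.* (rising x k ℚ.* y))
               (shift-≡ m i (+ 1)) (G-ext (shift-shift m i (+ 1) (+ k))) ⟩
    toℚ (m i ℤ.+ + 1) ℚ.* (rising (m i ℤ.+ + 1) k ℚ.* G (shift m i (+ suc k)))
      ≡⟨ sym (ℚP.*-assoc (toℚ (m i ℤ.+ + 1)) _ _) ⟩
    rising (m i) (suc k) ℚ.* G (shift m i (+ suc k)) ∎
    where
    open ≡-Reasoning
    m₁ = shift m i (+ 1)

  shift-cong : ∀ {x y : Fin N → ℤ} → (∀ j → x j ≡ y j) → ∀ i t j → shift x i t j ≡ shift y i t j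
  shift-cong x≗y i t j with j ≟F i
  ... | yes _ = cong (ℤ._+ t) (x≗y j)
  ... | no _ = x≗y j

  ∂-extensional : ∀ i {G} → Extensional G → Extensional (∂ i G)
  ∂-extensional i G-ext x≗y = cong₂ ℚ._*_ (cong (λ z → toℚ (z ℤ.+ + 1)) (x≗y i)) (G-ext (shift-cong x≗y i (+ 1)))

  ∂^-extensional : ∀ i k {G} → Extensional G → Extensional (∂^ i k G)
  ∂^-extensional i zero G-ext = G-ext
  ∂^-extensional i (suc k) G-ext = ∂-extensional i (∂^-extensional i k G-ext)

  ShiftedAlong : ∀ {M} → (Fin M → Fin N) → (Fin N → ℕ) → (m m′ : Fin N → ℤ) → Set
  ShiftedAlong ρ k m m′ = (∀ t → m′ (ρ t) ≡ m (ρ t) ℤ.+ + k (ρ t))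
                        × (∀ j → (∀ t → j ≢ ρ t) → m′ j ≡ m j)

  injective-suc≢zero : ∀ {M} {ρ : Fin (suc M) → Fin N} → Injective _≡_ _≡_ ρ → ∀ t → ρ (suc t) ≢ ρ zero
  injective-suc≢zero ρ-inj t eq with ρ-inj eq
  ... | ()

  ShiftedAlong-suc : ∀ {M} {ρ : Fin (suc M) → Fin N} {k m m′} → Injective _≡_ _≡_ ρ →
                     ShiftedAlong ρ k m m′ → ShiftedAlong (ρ ∘ suc) k (shift m (ρ zero) (+ k (ρ zero))) m′
  ShiftedAlong-suc {ρ = ρ} {k} {m} {m′} ρ-inj (on-ρ , off-ρ) = on-ρ′ , off-ρ′
    where
    on-ρ′ : ∀ t → m′ (ρ (suc t)) ≡ shift m (ρ zero) (+ k (ρ zero)) (ρ (suc t)) ℤ.+ + k (ρ (suc t))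
    on-ρ′ t = trans (on-ρ (suc t)) (cong (ℤ._+ + k (ρ (suc t))) (sym (shift-≢ m _ _ _ (injective-suc≢zero ρ-inj t))))
    off-ρ′ : ∀ j → (∀ t → j ≢ ρ (suc t)) → m′ j ≡ shift m (ρ zero) (+ k (ρ zero)) j
    off-ρ′ j j∉ρsuc with j ≟F ρ zero
    ... | yes refl = on-ρ zero
    ... | no j≢ρzero = off-ρ j λ { zero → j≢ρzero ; (suc t) → j∉ρsuc t }

  ∂along : ∀ {M} → (Fin M → Fin N) → (Fin N → ℕ) → Series N → Series N
  ∂along ρ k G = foldr (λ i H → ∂^ i (k i) H) G (tabulate ρ)

  ∂along-extensional : ∀ {M} (ρ : Fin M → Fin N) k {G} → Extensional G → Extensional (∂along ρ k G)
  ∂along-extensional {zero} ρ k G-ext = G-ext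
  ∂along-extensional {suc M} ρ k G-ext = ∂^-extensional (ρ zero) (k (ρ zero)) (∂along-extensional (ρ ∘ suc) k G-ext)

  ∂along-coeff : ∀ {M} (ρ : Fin M → Fin N) → Injective _≡_ _≡_ ρ →
                 ∀ k {G} → Extensional G → ∀ {m m′} → ShiftedAlong ρ k m m′ →
                 ∂along ρ k G m ≡ prodℚ (λ t → rising (m (ρ t)) (k (ρ t))) ℚ.* G m′
  ∂along-coeff {zero} ρ ρ-inj k G-ext (_ , off-ρ) =
    trans (G-ext (λ j → sym (off-ρ j λ ()))) (sym (ℚP.*-identityˡ _))
  ∂along-coeff {suc M} ρ ρ-inj k {G} G-ext {m} {m′} shifted = begin
    ∂^ (ρ zero) (k (ρ zero)) (∂along (ρ ∘ suc) k G) m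
      ≡⟨ ∂^-coeff (ρ zero) (k (ρ zero)) (∂along-extensional (ρ ∘ suc) k G-ext) m ⟩
    rising (m (ρ zero)) (k (ρ zero)) ℚ.* ∂along (ρ ∘ suc) k G m₁
      ≡⟨ cong (rising (m (ρ zero)) (k (ρ zero)) ℚ.*_)
           (∂along-coeff (ρ ∘ suc) (λ eq → FinP.suc-injective (ρ-inj eq)) k G-ext (ShiftedAlong-suc {k = k} ρ-inj shifted)) ⟩
    rising (m (ρ zero)) (k (ρ zero)) ℚ.* (prodℚ (λ t → rising (m₁ (ρ (suc t))) (k (ρ (suc t)))) ℚ.* G m′)
      ≡⟨ cong (λ p → rising (m (ρ zero)) (k (ρ zero)) ℚ.* (p ℚ.* G m′)) (Πℚ.⨁-cong λ t →
           cong (λ x → rising x (k (ρ (suc t)))) (shift-≢ m _ _ _ (injective-suc≢zero ρ-inj t))) ⟩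
    rising (m (ρ zero)) (k (ρ zero)) ℚ.* (prodℚ (λ t → rising (m (ρ (suc t))) (k (ρ (suc t)))) ℚ.* G m′)
      ≡⟨ sym (ℚP.*-assoc (rising (m (ρ zero)) (k (ρ zero))) (prodℚ (λ t → rising (m (ρ (suc t))) (k (ρ (suc t))))) (G m′)) ⟩
    prodℚ (λ t → rising (m (ρ t)) (k (ρ t))) ℚ.* G m′ ∎
    where
    open ≡-Reasoning
    m₁ = shift m (ρ zero) (+ k (ρ zero))

  ∂mono-coeff : ∀ k {G} → Extensional G → ∀ m →
                ∂mono k G m ≡ prodℚ (λ i → rising (m i) (k i)) ℚ.* G (m ⊕ k)
  ∂mono-coeff k G-ext m = ∂along-coeff id id k G-ext ((λ _ → refl) , λ j j∉ → ⊥-elim (j∉ j refl))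

  mulλ-∂ : ∀ j {G} → Extensional G → ∀ m → mulλ j (∂ j G) m ≡ toℚ (m j) ℚ.* G m
  mulλ-∂ j G-ext m = cong₂ ℚ._*_ (cong toℚ (begin
      shift m j -1ℤ j ℤ.+ + 1  ≡⟨ cong (ℤ._+ + 1) (shift-≡ m j -1ℤ) ⟩
      (m j ℤ.+ -1ℤ) ℤ.+ + 1    ≡⟨ ℤP.+-assoc (m j) -1ℤ (+ 1) ⟩
      m j ℤ.+ + 0              ≡⟨ ℤP.+-identityʳ (m j) ⟩
      m j                      ∎))
    (G-ext λ i → trans (shift-shift m j -1ℤ (+ 1) i) (shift-+0 m j i))
    where open ≡-Reasoning

  ⊕-zero : ∀ m (u : Fin N → ℕ) {i} → u i ≡ 0 → (m ⊕ u) i ≡ m i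
  ⊕-zero m u {i} uᵢ≡0 = trans (cong (λ z → m i ℤ.+ + z) uᵢ≡0) (ℤP.+-identityʳ (m i))

module Hypergeometric (r J K : ℕ) (c : Fin J → Fin r → ℕ) (d : Fin K → Fin r → ℕ) where
  open Setup r J K c d

  sᵢ : Fin r → Fin n
  sᵢ s = (s ↑ˡ J) ↑ˡ K

  cᵢ : Fin J → Fin n
  cᵢ j = (r ↑ʳ j) ↑ˡ K

  dᵢ : Fin K → Fin n
  dᵢ k = (r ℕ.+ J) ↑ʳ k

  data Row : Fin n → Set where
    s-row : ∀ s → Row (sᵢ s)
    c-row : ∀ j → Row (cᵢ j)
    d-row : ∀ k → Row (dᵢ k)

  row : ∀ i → Row i
  row i with splitAt (r ℕ.+ J) i in eq₁
  ... | inj₂ k = subst Row (splitAt⁻¹-↑ʳ eq₁) (d-row k)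
  ... | inj₁ i′ with splitAt r i′ in eq₂
  ...   | inj₁ s = subst Row (trans (cong (_↑ˡ K) (splitAt⁻¹-↑ˡ eq₂)) (splitAt⁻¹-↑ˡ eq₁)) (s-row s)
  ...   | inj₂ j = subst Row (trans (cong (_↑ˡ K) (splitAt⁻¹-↑ʳ eq₂)) (splitAt⁻¹-↑ˡ eq₁)) (c-row j)

  data Column : Fin N → Set where
    basis : ∀ u → Column (u ↑ˡ r)
    added : ∀ s → Column (n ↑ʳ s)

  column : ∀ i → Column i
  column i with splitAt n i in eq
  ... | inj₁ u = subst Column (splitAt⁻¹-↑ˡ eq) (basis u)
  ... | inj₂ s = subst Column (splitAt⁻¹-↑ʳ eq) (added s)

  expo-s : ∀ p s → expo p (sᵢ s ↑ˡ r) ≡ ℤ.- (+ p s) ℤ.- + 1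
  expo-s p s rewrite splitAt-↑ˡ n (sᵢ s) r | splitAt-↑ˡ (r ℕ.+ J) (s ↑ˡ J) K | splitAt-↑ˡ r s J = refl

  expo-c : ∀ p j → expo p (cᵢ j ↑ˡ r) ≡ ℤ.- (+ C j p) ℤ.- + 1
  expo-c p j rewrite splitAt-↑ˡ n (cᵢ j) r | splitAt-↑ˡ (r ℕ.+ J) (r ↑ʳ j) K | splitAt-↑ʳ r J j = refl

  expo-d : ∀ p k → expo p (dᵢ k ↑ˡ r) ≡ + D k p
  expo-d p k rewrite splitAt-↑ˡ n (dᵢ k) r | splitAt-↑ʳ (r ℕ.+ J) K k = refl

  expo-added : ∀ p s → expo p (n ↑ʳ s) ≡ + p s
  expo-added p s rewrite splitAt-↑ʳ n r s = refl

  β0-s : ∀ s → β0 (sᵢ s) ≡ -[1+ 0 ]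
  β0-s s rewrite splitAt-↑ˡ (r ℕ.+ J) (s ↑ˡ J) K = refl

  β0-c : ∀ j → β0 (cᵢ j) ≡ -[1+ 0 ]
  β0-c j rewrite splitAt-↑ˡ (r ℕ.+ J) (r ↑ʳ j) K = refl

  β0-d : ∀ k → β0 (dᵢ k) ≡ + 0
  β0-d k rewrite splitAt-↑ʳ (r ℕ.+ J) K k = refl

  extra-s : ∀ t s → extra t (sᵢ s) ≡ δ s t
  extra-s t s rewrite splitAt-↑ˡ (r ℕ.+ J) (s ↑ˡ J) K | splitAt-↑ˡ r s J = refl

  extra-c : ∀ t j → extra t (cᵢ j) ≡ + c j t
  extra-c t j rewrite splitAt-↑ˡ (r ℕ.+ J) (r ↑ʳ j) K | splitAt-↑ʳ r J j = refl

  extra-d : ∀ t k → extra t (dᵢ k) ≡ ℤ.- (+ d k t)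
  extra-d t k rewrite splitAt-↑ʳ (r ℕ.+ J) K k = refl

  col-basis : ∀ u i → col (u ↑ˡ r) i ≡ δ u i
  col-basis u i rewrite splitAt-↑ˡ n u r = refl

  col-added : ∀ t i → col (n ↑ʳ t) i ≡ extra t i
  col-added t i rewrite splitAt-↑ʳ n r t = refl

  A· : (Fin N → ℤ) → Fin n → ℤ
  A· w i = sumℤ (λ j → w j ℤ.* a i j)

  δ-≡ : ∀ {M} (u : Fin M) → δ u u ≡ + 1
  δ-≡ u with u ≟F u
  ... | yes _ = refl
  ... | no u≢u = ⊥-elim (u≢u refl)

  δ-≢ : ∀ {M} {u i : Fin M} → u ≢ i → δ u i ≡ + 0
  δ-≢ {u = u} {i} u≢i with u ≟F i
  ... | yes u≡i = ⊥-elim (u≢i u≡i)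
  ... | no _ = refl

  A·-split : ∀ w i → A· w i ≡ w (i ↑ˡ r) ℤ.+ sumℤ (λ t → w (n ↑ʳ t) ℤ.* extra t i)
  A·-split w i = trans (Σℤ.⨁-↑ n (λ j → w j ℤ.* a i j)) (cong₂ ℤ._+_
    (trans (Σℤ.⨁-cong λ u → cong (w (u ↑ˡ r) ℤ.*_) (col-basis u i))
           (sum-δ (λ u → w (u ↑ˡ r)) (λ u → δ u i) (δ-≡ i) δ-≢))
    (Σℤ.⨁-cong λ t → cong (w (n ↑ʳ t) ℤ.*_) (col-added t i)))

  A·-s : ∀ w s → A· w (sᵢ s) ≡ w (sᵢ s ↑ˡ r) ℤ.+ w (n ↑ʳ s)
  A·-s w s = trans (A·-split w (sᵢ s)) (cong (ℤ._+_ (w (sᵢ s ↑ˡ r)))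
    (trans (Σℤ.⨁-cong λ t → cong (w (n ↑ʳ t) ℤ.*_) (extra-s t s))
           (sum-δ (λ t → w (n ↑ʳ t)) (δ s) (δ-≡ s) (λ t≢s → δ-≢ (t≢s ∘ sym)))))

  A·-c : ∀ w j → A· w (cᵢ j) ≡ w (cᵢ j ↑ˡ r) ℤ.+ sumℤ (λ t → w (n ↑ʳ t) ℤ.* + c j t)
  A·-c w j = trans (A·-split w (cᵢ j)) (cong (ℤ._+_ (w (cᵢ j ↑ˡ r)))
    (Σℤ.⨁-cong λ t → cong (w (n ↑ʳ t) ℤ.*_) (extra-c t j)))

  A·-d : ∀ w k → A· w (dᵢ k) ≡ w (dᵢ k ↑ˡ r) ℤ.- sumℤ (λ t → w (n ↑ʳ t) ℤ.* + d k t)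
  A·-d w k = trans (A·-split w (dᵢ k)) (cong (ℤ._+_ (w (dᵢ k ↑ˡ r))) (begin
    sumℤ (λ t → w (n ↑ʳ t) ℤ.* extra t (dᵢ k))   ≡⟨ Σℤ.⨁-cong (λ t → trans (cong (w (n ↑ʳ t) ℤ.*_) (extra-d t k))
                                                                       (sym (ℤP.neg-distribʳ-* (w (n ↑ʳ t)) (+ d k t)))) ⟩
    sumℤ (λ t → ℤ.- (w (n ↑ʳ t) ℤ.* + d k t))  ≡⟨ Σℤ-neg (λ t → w (n ↑ʳ t) ℤ.* + d k t) ⟩
    ℤ.- sumℤ (λ t → w (n ↑ʳ t) ℤ.* + d k t)    ∎))
    where open ≡-Reasoning

  A·-+ : ∀ x y i → A· (λ j → x j ℤ.+ y j) i ≡ A· x i ℤ.+ A· y i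
  A·-+ x y i = trans (Σℤ.⨁-cong λ j → ℤP.*-distribʳ-+ (a i j) (x j) (y j))
                     (Σℤ.⨁-∙ (λ j → x j ℤ.* a i j) (λ j → y j ℤ.* a i j))

  C-weighted : ∀ j p → + C j p ≡ sumℤ (λ t → + p t ℤ.* + c j t)
  C-weighted j = weighted-sum (c j)

  D-weighted : ∀ k p → + D k p ≡ sumℤ (λ t → + p t ℤ.* + d k t)
  D-weighted k = weighted-sum (d k)

  expo-solves : ∀ p i → A· (expo p) i ≡ β0 i
  expo-solves p i with row i
  ... | s-row s = begin
    A· (expo p) (sᵢ s)                                ≡⟨ A·-s (expo p) s ⟩
    expo p (sᵢ s ↑ˡ r) ℤ.+ expo p (n ↑ʳ s)            ≡⟨ cong₂ ℤ._+_ (expo-s p s) (expo-added p s) ⟩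
    (ℤ.- (+ p s) ℤ.- + 1) ℤ.+ + p s                   ≡⟨ -x-1+x≡-1 (+ p s) ⟩
    -[1+ 0 ]                                          ≡⟨ sym (β0-s s) ⟩
    β0 (sᵢ s)                                         ∎
    where open ≡-Reasoning
  ... | c-row j = begin
    A· (expo p) (cᵢ j)                                            ≡⟨ A·-c (expo p) j ⟩
    expo p (cᵢ j ↑ˡ r) ℤ.+ sumℤ (λ t → expo p (n ↑ʳ t) ℤ.* + c j t)
      ≡⟨ cong₂ ℤ._+_ (expo-c p j) (trans (Σℤ.⨁-cong λ t → cong (ℤ._* + c j t) (expo-added p t)) (sym (C-weighted j p))) ⟩
    (ℤ.- (+ C j p) ℤ.- + 1) ℤ.+ + C j p                           ≡⟨ -x-1+x≡-1 (+ C j p) ⟩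
    -[1+ 0 ]                                                      ≡⟨ sym (β0-c j) ⟩
    β0 (cᵢ j)                                                     ∎
    where open ≡-Reasoning
  ... | d-row k = begin
    A· (expo p) (dᵢ k)                                            ≡⟨ A·-d (expo p) k ⟩
    expo p (dᵢ k ↑ˡ r) ℤ.- sumℤ (λ t → expo p (n ↑ʳ t) ℤ.* + d k t)
      ≡⟨ cong₂ ℤ._-_ (expo-d p k) (trans (Σℤ.⨁-cong λ t → cong (ℤ._* + d k t) (expo-added p t)) (sym (D-weighted k p))) ⟩
    + D k p ℤ.- + D k p                                           ≡⟨ ℤP.+-inverseʳ (+ D k p) ⟩
    + 0                                                           ≡⟨ sym (β0-d k) ⟩
    β0 (dᵢ k)                                                     ∎
    where open ≡-Reasoning

  solution-is-expo : ∀ m q → (∀ t → + q t ≡ m (n ↑ʳ t)) → (∀ i → A· m i ≡ β0 i) → ∀ i → m i ≡ expo q i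
  solution-is-expo m q +q m-solves i with column i
  ... | added s = trans (sym (+q s)) (sym (expo-added q s))
  ... | basis u with row u
  ...   | s-row s = begin
    m (sᵢ s ↑ˡ r)                 ≡⟨ x+y≡b⇒x≡-y+b _ _ _ (trans (sym (A·-s m s)) (trans (m-solves (sᵢ s)) (β0-s s))) ⟩
    ℤ.- m (n ↑ʳ s) ℤ.+ -[1+ 0 ]    ≡⟨ cong (λ y → ℤ.- y ℤ.+ -[1+ 0 ]) (sym (+q s)) ⟩
    ℤ.- (+ q s) ℤ.- + 1            ≡⟨ sym (expo-s q s) ⟩
    expo q (sᵢ s ↑ˡ r)            ∎
    where open ≡-Reasoning
  ...   | c-row j = begin
    m (cᵢ j ↑ˡ r)
      ≡⟨ x+y≡b⇒x≡-y+b _ _ _ (trans (sym (A·-c m j)) (trans (m-solves (cᵢ j)) (β0-c j))) ⟩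
    ℤ.- sumℤ (λ t → m (n ↑ʳ t) ℤ.* + c j t) ℤ.+ -[1+ 0 ]   ≡⟨ cong (λ y → ℤ.- y ℤ.+ -[1+ 0 ]) C-q ⟩
    ℤ.- (+ C j q) ℤ.- + 1                                  ≡⟨ sym (expo-c q j) ⟩
    expo q (cᵢ j ↑ˡ r)                                    ∎
    where
    open ≡-Reasoning
    C-q : sumℤ (λ t → m (n ↑ʳ t) ℤ.* + c j t) ≡ + C j q
    C-q = trans (Σℤ.⨁-cong λ t → cong (ℤ._* + c j t) (sym (+q t))) (sym (C-weighted j q))
  ...   | d-row k = begin
    m (dᵢ k ↑ˡ r)
      ≡⟨ x∙y⁻¹≈ε⇒x≈y _ _ (trans (sym (A·-d m k)) (trans (m-solves (dᵢ k)) (β0-d k))) ⟩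
    sumℤ (λ t → m (n ↑ʳ t) ℤ.* + d k t)  ≡⟨ D-q ⟩
    + D k q                              ≡⟨ sym (expo-d q k) ⟩
    expo q (dᵢ k ↑ˡ r)                   ∎
    where
    open ≡-Reasoning
    D-q : sumℤ (λ t → m (n ↑ʳ t) ℤ.* + d k t) ≡ + D k q
    D-q = trans (Σℤ.⨁-cong λ t → cong (ℤ._* + d k t) (sym (+q t))) (sym (D-weighted k q))

  A·-cong : ∀ {x y} → (∀ j → x j ≡ y j) → ∀ i → A· x i ≡ A· y i
  A·-cong x≗y i = Σℤ.⨁-cong λ j → cong (ℤ._* a i j) (x≗y j)

  Supported : (Fin N → ℤ) → Set
  Supported m = Σ (Fin r → ℕ) λ p → ∀ i → m i ≡ expo p i

  supported-solves : ∀ {m} → Supported m → ∀ i → A· m i ≡ β0 i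
  supported-solves (p , m≗expo) i = trans (A·-cong m≗expo i) (expo-solves p i)

  supported-nonneg : ∀ {m} → Supported m → ∀ s → + 0 ℤ.≤ m (n ↑ʳ s)
  supported-nonneg (p , m≗expo) s = subst (+ 0 ℤ.≤_) (sym (trans (m≗expo (n ↑ʳ s)) (expo-added p s))) (+≤+ z≤n)

  decode : (Fin N → ℤ) → Fin r → ℕ
  decode m s = ℤ.∣ m (n ↑ʳ s) ∣

  supported-decode : ∀ {m} → Supported m → ∀ i → m i ≡ expo (decode m) i
  supported-decode m-supp = solution-is-expo _ _ (λ t → ℤP.0≤i⇒+∣i∣≡i (supported-nonneg m-supp t)) (supported-solves m-supp)

  supported? : ∀ m → Dec (Supported m)
  supported? m with all? (λ s → + 0 ℤ.≤? m (n ↑ʳ s))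
  ... | no ¬nonneg = no (¬nonneg ∘ supported-nonneg)
  ... | yes _ with all? (λ i → m i ℤP.≟ expo (decode m) i)
  ...   | yes m≗expo = yes (decode m , m≗expo)
  ...   | no ¬m≗expo = no (¬m≗expo ∘ supported-decode)

  Πℚ-blocks : ∀ (f : Fin N → ℚ) → prodℚ f ≡
    ((prodℚ (λ s → f (sᵢ s ↑ˡ r)) ℚ.* prodℚ (λ j → f (cᵢ j ↑ˡ r))) ℚ.* prodℚ (λ k → f (dᵢ k ↑ˡ r)))
      ℚ.* prodℚ (λ s → f (n ↑ʳ s))
  Πℚ-blocks f = trans (Πℚ.⨁-↑ n f) (cong (ℚ._* prodℚ (λ s → f (n ↑ʳ s)))
    (trans (Πℚ.⨁-↑ (r ℕ.+ J) (λ u → f (u ↑ˡ r)))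
           (cong (ℚ._* prodℚ (λ k → f (dᵢ k ↑ˡ r))) (Πℚ.⨁-↑ r (λ v → f ((v ↑ˡ K) ↑ˡ r))))))

  Πγ-expo : ∀ p → prodℚ (λ i → γ (expo p i)) ≡ coeff p
  Πγ-expo p = begin
    prodℚ (λ i → γ (expo p i))
      ≡⟨ Πℚ-blocks (λ i → γ (expo p i)) ⟩
    ((prodℚ (λ s → γ (expo p (sᵢ s ↑ˡ r))) ℚ.* prodℚ (λ j → γ (expo p (cᵢ j ↑ˡ r))))
      ℚ.* prodℚ (λ k → γ (expo p (dᵢ k ↑ˡ r)))) ℚ.* prodℚ (λ s → γ (expo p (n ↑ʳ s)))
      ≡⟨ cong₂ ℚ._*_ (cong₂ ℚ._*_ (cong₂ ℚ._*_
           (Πℚ.⨁-cong λ s → cong γ (trans (expo-s p s) (-+a-1≡-[1+a] (p s))))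
           (trans (Πℚ.⨁-cong λ j → cong γ (trans (expo-c p j) (-+a-1≡-[1+a] (C j p))))
                  (Πℚ.⨁-∙ (λ j → sign (C j p)) (λ j → toℚ (+ (C j p !))))))
           (Πℚ.⨁-cong λ k → cong γ (expo-d p k)))
           (Πℚ.⨁-cong λ s → cong γ (expo-added p s)) ⟩
    ((Γs ℚ.* (±C ℚ.* C!)) ℚ.* D!) ℚ.* Γp
      ≡⟨ solve 5 (λ a b c d e → ((a :* (b :* c)) :* d) :* e := ((a :* e) :* b) :* c :* d) refl Γs ±C C! D! Γp ⟩
    (((Γs ℚ.* Γp) ℚ.* ±C) ℚ.* C!) ℚ.* D!
      ≡⟨ cong (λ x → (x ℚ.* C!) ℚ.* D!) (cong₂ ℚ._*_ Γs*Γp (Πℚ-sign (λ j → C j p))) ⟩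
    ((sign (sumℕ p) ℚ.* sign (sumℕ (λ j → C j p))) ℚ.* C!) ℚ.* D!
      ≡⟨ cong (λ x → (x ℚ.* C!) ℚ.* D!) (sym (sign-+ (sumℕ p) (sumℕ (λ j → C j p)))) ⟩
    coeff p ∎
    where
    open ≡-Reasoning
    open ℚ-Solver
    Γs = prodℚ (λ s → γ -[1+ p s ])
    Γp = prodℚ (λ s → γ (+ p s))
    ±C = prodℚ (λ j → sign (C j p))
    C! = prodℚ (λ j → toℚ (+ (C j p !)))
    D! = prodℚ (λ k → γ (+ D k p))
    Γs*Γp : Γs ℚ.* Γp ≡ sign (sumℕ p)
    Γs*Γp = trans (sym (Πℚ.⨁-∙ (λ s → γ -[1+ p s ]) (λ s → γ (+ p s))))
                  (trans (Πℚ.⨁-cong λ s → γ-reflection (p s)) (Πℚ-sign p))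

  F-supported : ∀ {m} → Supported m → F m ≡ prodℚ (λ i → γ (m i))
  F-supported {m} m-supp with all? (λ s → + 0 ℤ.≤? m (n ↑ʳ s))
  ... | no ¬nonneg = ⊥-elim (¬nonneg (supported-nonneg m-supp))
  ... | yes _ = begin
    (if does (all? (λ i → m i ℤP.≟ expo (decode m) i)) then coeff (decode m) else 0ℚ)
      ≡⟨ cong (if_then coeff (decode m) else 0ℚ) (dec-true (all? (λ i → m i ℤP.≟ expo (decode m) i)) (supported-decode m-supp)) ⟩
    coeff (decode m)                      ≡⟨ sym (Πγ-expo (decode m)) ⟩
    prodℚ (λ i → γ (expo (decode m) i))   ≡⟨ Πℚ.⨁-cong (λ i → cong γ (sym (supported-decode m-supp i))) ⟩
    prodℚ (λ i → γ (m i))                 ∎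
    where open ≡-Reasoning

  F-unsupported : ∀ {m} → ¬ Supported m → F m ≡ 0ℚ
  F-unsupported {m} ¬m-supp with all? (λ s → + 0 ℤ.≤? m (n ↑ʳ s))
  ... | no _ = refl
  ... | yes _ = cong (if_then coeff (decode m) else 0ℚ)
                     (dec-false (all? (λ i → m i ℤP.≟ expo (decode m) i)) (λ m≗expo → ¬m-supp (decode m , m≗expo)))

  F-extensional : Extensional F
  F-extensional {x} {y} x≗y with supported? x
  ... | yes (p , x≗expo) = begin
    F x                    ≡⟨ F-supported (p , x≗expo) ⟩
    prodℚ (λ i → γ (x i))  ≡⟨ Πℚ.⨁-cong (λ i → cong γ (x≗y i)) ⟩
    prodℚ (λ i → γ (y i))  ≡⟨ sym (F-supported (p , λ i → trans (sym (x≗y i)) (x≗expo i))) ⟩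
    F y                    ∎
    where open ≡-Reasoning
  ... | no ¬x-supp = trans (F-unsupported ¬x-supp)
    (sym (F-unsupported λ { (p , y≗expo) → ¬x-supp (p , λ i → trans (x≗y i) (y≗expo i)) }))

  euler-coeff : ∀ {G} → Extensional G → ∀ i m →
                euler i G m ≡ toℚ (A· m i) ℚ.* G m ℚ.- toℚ (β0 i) ℚ.* G m
  euler-coeff {G} G-ext i m = cong (ℚ._- toℚ (β0 i) ℚ.* G m) (begin
    sumℚ (λ j → toℚ (a i j) ℚ.* mulλ j (∂ j G) m)
      ≡⟨ Σℚ.⨁-cong (λ j → cong (toℚ (a i j) ℚ.*_) (mulλ-∂ j G-ext m)) ⟩
    sumℚ (λ j → toℚ (a i j) ℚ.* (toℚ (m j) ℚ.* G m))
      ≡⟨ Σℚ.⨁-cong (λ j → trans (sym (ℚP.*-assoc (toℚ (a i j)) (toℚ (m j)) (G m)))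
                                 (cong (ℚ._* G m) (trans (sym (toℚ-* (a i j) (m j))) (cong toℚ (ℤP.*-comm (a i j) (m j)))))) ⟩
    sumℚ (λ j → toℚ (m j ℤ.* a i j) ℚ.* G m)
      ≡⟨ sym (⨁-homo Σℤ Σℚ (λ z → toℚ z ℚ.* G m) (ℚP.*-zeroˡ (G m))
               (λ x y → trans (cong (ℚ._* G m) (toℚ-+ x y)) (ℚP.*-distribʳ-+ (G m) (toℚ x) (toℚ y))) (λ j → m j ℤ.* a i j)) ⟩
    toℚ (A· m i) ℚ.* G m ∎)
    where open ≡-Reasoning

  euler-F : ∀ i m → euler i F m ≡ 0ℚ
  euler-F i m with supported? m
  ... | yes m-supp = trans (euler-coeff F-extensional i m)
    (trans (cong (λ z → toℚ z ℚ.* F m ℚ.- toℚ (β0 i) ℚ.* F m) (supported-solves m-supp i))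
           (ℚP.+-inverseʳ (toℚ (β0 i) ℚ.* F m)))
  ... | no ¬m-supp = trans (euler-coeff F-extensional i m)
    (trans (cong (λ z → toℚ (A· m i) ℚ.* z ℚ.- toℚ (β0 i) ℚ.* z) (F-unsupported ¬m-supp))
           (cong₂ ℚ._-_ (ℚP.*-zeroʳ (toℚ (A· m i))) (ℚP.*-zeroʳ (toℚ (β0 i)))))

  expo-sign-invariant : ∀ p q i → + 0 ℤ.≤ expo p i → + 0 ℤ.≤ expo q i
  expo-sign-invariant p q i 0≤expo with column i
  ... | added s = subst (+ 0 ℤ.≤_) (sym (expo-added q s)) (+≤+ z≤n)
  ... | basis u with row u
  ...   | s-row s = ⊥-elim (ℤP.<⇒≱ ℤ.-<+ (subst (+ 0 ℤ.≤_) (trans (expo-s p s) (-+a-1≡-[1+a] (p s))) 0≤expo))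
  ...   | c-row j = ⊥-elim (ℤP.<⇒≱ ℤ.-<+ (subst (+ 0 ℤ.≤_) (trans (expo-c p j) (-+a-1≡-[1+a] (C j p))) 0≤expo))
  ...   | d-row k = subst (+ 0 ℤ.≤_) (sym (expo-d q k)) (+≤+ z≤n)

  Disjoint : (u v : Fin N → ℕ) → Set
  Disjoint u v = ∀ i → u i ≡ 0 ⊎ v i ≡ 0

  ∂mono-F : ∀ u m → ∂mono u F m ≡ prodℚ (λ i → rising (m i) (u i)) ℚ.* F (m ⊕ u)
  ∂mono-F u = ∂mono-coeff u F-extensional

  ∂mono-F-both-supported : ∀ {u v} m → Disjoint u v → Supported (m ⊕ u) → Supported (m ⊕ v) →
                           ∂mono u F m ≡ prodℚ (λ i → γ (m i))
  ∂mono-F-both-supported {u} {v} m disjoint (p , m⊕u≗expo) (q , m⊕v≗expo) = begin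
    ∂mono u F m
      ≡⟨ ∂mono-F u m ⟩
    prodℚ (λ i → rising (m i) (u i)) ℚ.* F (m ⊕ u)
      ≡⟨ cong (prodℚ (λ i → rising (m i) (u i)) ℚ.*_) (F-supported (p , m⊕u≗expo)) ⟩
    prodℚ (λ i → rising (m i) (u i)) ℚ.* prodℚ (λ i → γ ((m ⊕ u) i))
      ≡⟨ sym (Πℚ.⨁-∙ (λ i → rising (m i) (u i)) (λ i → γ ((m ⊕ u) i))) ⟩
    prodℚ (λ i → rising (m i) (u i) ℚ.* γ ((m ⊕ u) i))
      ≡⟨ Πℚ.⨁-cong (λ i → rising-γ (u i) (m i) (no-crossing i)) ⟩
    prodℚ (λ i → γ (m i)) ∎
    where
    open ≡-Reasoning
    no-crossing : ∀ i → ¬ (m i ℤ.< + 0 × + 0 ℤ.≤ (m ⊕ u) i)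
    no-crossing i (m<0 , 0≤m⊕u) with disjoint i
    ... | inj₁ uᵢ≡0 = ℤP.<⇒≱ m<0 (subst (+ 0 ℤ.≤_) (⊕-zero m u uᵢ≡0) 0≤m⊕u)
    ... | inj₂ vᵢ≡0 = ℤP.<⇒≱ m<0 (subst (+ 0 ℤ.≤_) (trans (sym (m⊕v≗expo i)) (⊕-zero m v vᵢ≡0))
                        (expo-sign-invariant p q i (subst (+ 0 ℤ.≤_) (m⊕u≗expo i) 0≤m⊕u)))

  ∂mono-F-crossing : ∀ {u v} m → Disjoint u v → Supported (m ⊕ u) → ∀ s → (m ⊕ v) (n ↑ʳ s) ℤ.< + 0 →
                     ∂mono u F m ≡ 0ℚ
  ∂mono-F-crossing {u} {v} m disjoint m⊕u-supp s m⊕v<0 = begin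
    ∂mono u F m                                      ≡⟨ ∂mono-F u m ⟩
    prodℚ (λ i → rising (m i) (u i)) ℚ.* F (m ⊕ u)
      ≡⟨ cong (ℚ._* F (m ⊕ u)) (Πℚ.⨁-zeroFactor ℚP.*-zeroˡ ℚP.*-zeroʳ (λ i → rising (m i) (u i)) i rising≡0) ⟩
    0ℚ ℚ.* F (m ⊕ u)                                  ≡⟨ ℚP.*-zeroˡ (F (m ⊕ u)) ⟩
    0ℚ                                               ∎
    where
    open ≡-Reasoning
    i = n ↑ʳ s
    0≤m⊕u : + 0 ℤ.≤ (m ⊕ u) i
    0≤m⊕u = supported-nonneg m⊕u-supp s
    rising≡0 : rising (m i) (u i) ≡ 0ℚ
    rising≡0 with disjoint i
    ... | inj₁ uᵢ≡0 =
      ⊥-elim (ℤP.<⇒≱ m⊕v<0 (ℤP.≤-trans (subst (+ 0 ℤ.≤_) (⊕-zero m u uᵢ≡0) 0≤m⊕u) (ℤP.i≤i+j (m i) (+ v i))))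
    ... | inj₂ vᵢ≡0 = rising-crossing (u i) (m i) (subst (ℤ._< + 0) (⊕-zero m v vᵢ≡0) m⊕v<0) 0≤m⊕u

  ∂mono-F-unsupported : ∀ u m → ¬ Supported (m ⊕ u) → ∂mono u F m ≡ 0ℚ
  ∂mono-F-unsupported u m ¬supp =
    trans (∂mono-F u m) (trans (cong (prodℚ (λ i → rising (m i) (u i)) ℚ.*_) (F-unsupported ¬supp))
                               (ℚP.*-zeroʳ (prodℚ (λ i → rising (m i) (u i)))))

  unsupported-solution-negative : ∀ x → (∀ i → A· x i ≡ β0 i) → ¬ Supported x →
                                  Σ (Fin r) λ s → x (n ↑ʳ s) ℤ.< + 0
  unsupported-solution-negative x x-solves ¬x-supp with all? (λ s → + 0 ℤ.≤? x (n ↑ʳ s))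
  ... | yes nonneg = ⊥-elim (¬x-supp (decode x , solution-is-expo x (decode x) (λ t → ℤP.0≤i⇒+∣i∣≡i (nonneg t)) x-solves))
  ... | no ¬nonneg with FinP.¬∀⟶∃¬ r _ (λ s → + 0 ℤ.≤? x (n ↑ʳ s)) ¬nonneg
  ...   | s , x≱0 = s , ℤP.≰⇒> x≱0

  ∂mono-F-one-sided : ∀ {u v} m → Disjoint u v → Supported (m ⊕ u) → (∀ i → A· (m ⊕ v) i ≡ β0 i) →
                      ∂mono u F m ≡ ∂mono v F m
  ∂mono-F-one-sided {u} {v} m disjoint m⊕u-supp m⊕v-solves with supported? (m ⊕ v)
  ... | yes m⊕v-supp = trans (∂mono-F-both-supported m disjoint m⊕u-supp m⊕v-supp)
                        (sym (∂mono-F-both-supported m (swap ∘ disjoint) m⊕v-supp m⊕u-supp))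
  ... | no ¬m⊕v-supp with unsupported-solution-negative (m ⊕ v) m⊕v-solves ¬m⊕v-supp
  ...   | s , m⊕v<0 = trans (∂mono-F-crossing m disjoint m⊕u-supp s m⊕v<0) (sym (∂mono-F-unsupported v m ¬m⊕v-supp))

  ∂mono-F-balanced : ∀ {u v} m → Disjoint u v → (∀ i → A· (m ⊕ u) i ≡ A· (m ⊕ v) i) →
                     ∂mono u F m ≡ ∂mono v F m
  ∂mono-F-balanced {u} {v} m disjoint A·-balanced with supported? (m ⊕ u) | supported? (m ⊕ v)
  ... | yes m⊕u-supp | _ =
    ∂mono-F-one-sided m disjoint m⊕u-supp (λ i → trans (sym (A·-balanced i)) (supported-solves m⊕u-supp i))
  ... | no _ | yes m⊕v-supp =
    sym (∂mono-F-one-sided m (swap ∘ disjoint) m⊕v-supp (λ i → trans (A·-balanced i) (supported-solves m⊕v-supp i)))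
  ... | no ¬m⊕u-supp | no ¬m⊕v-supp =
    trans (∂mono-F-unsupported u m ¬m⊕u-supp) (sym (∂mono-F-unsupported v m ¬m⊕v-supp))

  lattice-balances : ∀ l → inL l → ∀ m i → A· (m ⊕ (pos ∘ l)) i ≡ A· (m ⊕ (neg ∘ l)) i
  lattice-balances l l∈L m i = begin
    A· (m ⊕ (pos ∘ l)) i
      ≡⟨ A·-cong (λ j → trans (cong (ℤ._+_ (m j)) (pos-neg-split (l j))) (sym (ℤP.+-assoc (m j) (+ neg (l j)) (l j)))) i ⟩
    A· (λ j → (m ⊕ (neg ∘ l)) j ℤ.+ l j) i  ≡⟨ A·-+ (m ⊕ (neg ∘ l)) l i ⟩
    A· (m ⊕ (neg ∘ l)) i ℤ.+ A· l i          ≡⟨ cong (ℤ._+_ (A· (m ⊕ (neg ∘ l)) i)) (l∈L i) ⟩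
    A· (m ⊕ (neg ∘ l)) i ℤ.+ + 0             ≡⟨ ℤP.+-identityʳ _ ⟩
    A· (m ⊕ (neg ∘ l)) i                    ∎
    where open ≡-Reasoning

  box-F : ∀ l → inL l → ∀ m → box l F m ≡ 0ℚ
  box-F l l∈L m = begin
    ∂mono (pos ∘ l) F m ℚ.- ∂mono (neg ∘ l) F m
      ≡⟨ cong (ℚ._- ∂mono (neg ∘ l) F m) (∂mono-F-balanced m (pos-neg-disjoint ∘ l) (lattice-balances l l∈L m)) ⟩
    ∂mono (neg ∘ l) F m ℚ.- ∂mono (neg ∘ l) F m
      ≡⟨ ℚP.+-inverseʳ (∂mono (neg ∘ l) F m) ⟩
    0ℚ ∎
    where open ≡-Reasoning

proposition3p7 : (r J K : ℕ) → 0 < r → 0 < J → 0 < K →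
    (c : Fin J → Fin r → ℕ) → (d : Fin K → Fin r → ℕ) →
    (∀ j → ¬ (∀ s → c j s ≡ 0)) →
    (∀ k → ¬ (∀ s → d k s ≡ 0)) →
    (∀ j k → ¬ (∀ s → c j s ≡ d k s)) →
    (∀ s → Σ (Fin J) (λ j → ¬ (c j s ≡ 0)) ⊎ Σ (Fin K) (λ k → ¬ (d k s ≡ 0))) →
    (∀ s → sumℕ (λ j → c j s) ≡ sumℕ (λ k → d k s)) →
    ((l : Fin (Setup.N r J K c d) → ℤ) → Setup.inL r J K c d l →
       Setup.box r J K c d l (Setup.F r J K c d) ≐ zeroS)
    × ((i : Fin (Setup.n r J K c d)) →
       Setup.euler r J K c d i (Setup.F r J K c d) ≐ zeroS)
proposition3p7 r J K _ _ _ c d _ _ _ _ _ = box-F , euler-F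
  where open Hypergeometric r J K c d
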